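{- Let $K=\mathbb{Q}(\sqrt{ -d})$ with $d>0$ squarefree and discriminant $-D$, and let $S$ be a finite set of rational primes with associated set $T$. For $k\in T$ and integers $0\le j\le k$ define the open interval $$I_j^k=\left(\frac{j-\sqrt{3/D}}{k},\ \frac{j+\sqrt{3/D}}{k}\right).$$ If $[0,1]\cap\mathbb{Q}\subseteq\bigcup_{k\in T}\bigcup_{0\le j\le k} I_j^k$, then $K$ is $S$-norm-Euclidean.
   Context: $D=4d$ if $-d\equiv 2,3\pmod 4$ and $D=d$ if $-d\equiv 1\pmod 4$. Put $w=\sqrt{ -d}$ if $-d\equiv 2,3\pmod 4$ and $w=(1+\sqrt{ -d})/2$ if $-d\equiv 1\pmod 4$. The norm is $N(x+y\sqrt{ -d})=x^2+dy^2$. $T$ is the set of positive integers all of whose prime factors lie in $S$ (so $1\in T$), and $\mathcal{O}_S=\{(a+bw)/c: a,b\in\mathbb{Z}, c\in T\}$. For nonzero $\xi\in K$, $N_S(\xi)$ is the positive rational obtained from $N(\xi)$ by deleting all primes of $S$ from the prime factorizations of its numerator and denominator; $N_S(0)=0$. $K$ is $S$-norm-Euclidean if for every $\xi\in K$ there exists $\gamma\in\mathcal{O}_S$ with $N_S(\xi-\gamma)<1$. -}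

module Defs where

open import Data.Nat as ℕ using (ℕ; zero; suc; _∸_)
open import Data.Nat.DivMod using (_/_; _%_)
open import Data.Nat.Divisibility using (_∣_; _∣?_)
open import Data.Nat.Primality using (Prime)
open import Data.Integer as ℤ using (ℤ; +_)
open import Data.Rational as ℚ using (ℚ; ↥_; ↧ₙ_; 0ℚ; 1ℚ)
open import Data.List using (List; foldr)
open import Data.List.Membership.Propositional using (_∈_)
open import Data.List.Relation.Unary.All using (All)
open import Data.Product using (Σ; _×_; ∃; ∃-syntax; _,_)
open import Relation.Binary.PropositionalEquality using (_≡_)
open import Relation.Nullary using (yes; no)

ℕ→ℚ : ℕ → ℚ
ℕ→ℚ n = (+ n) ℚ./ 1

ℤ→ℚ : ℤ → ℚ
ℤ→ℚ z = z ℚ./ 1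

Squarefree : ℕ → Set
Squarefree d = ∀ m → (m ℕ.* m) ∣ d → m ≡ 1

-- -d ≡ 1 (mod 4)  iff  d ≡ 3 (mod 4)
MinusDOneMod4 : ℕ → Set
MinusDOneMod4 d = d % 4 ≡ 3

discD : ℕ → ℕ
discD d with d % 4 ℕ.≟ 3
... | yes _ = d
... | no  _ = 4 ℕ.* d

-- Elements of K = ℚ(√-d) as pairs (x , y) meaning x + y√-d
K : Set
K = ℚ × ℚ

_-K_ : K → K → K
(x₁ , y₁) -K (x₂ , y₂) = (x₁ ℚ.- x₂ , y₁ ℚ.- y₂)

-- w = √-d, or (1+√-d)/2 when -d ≡ 1 (mod 4)
wK : ℕ → K
wK d with d % 4 ℕ.≟ 3
... | yes _ = ((+ 1) ℚ./ 2 , (+ 1) ℚ./ 2)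
... | no  _ = (0ℚ , 1ℚ)

normK : ℕ → K → ℚ
normK d (x , y) = x ℚ.* x ℚ.+ ℕ→ℚ d ℚ.* (y ℚ.* y)

PrimeSet : List ℕ → Set
PrimeSet S = All Prime S

InT : List ℕ → ℕ → Set
InT S c = (0 ℕ.< c) × (∀ p → Prime p → p ∣ c → p ∈ S)

-- O_S = {(a + b w)/c : a, b ∈ ℤ, c ∈ T}, i.e. γ ∈ O_S iff c·γ = a + b w
InOS : ℕ → List ℕ → K → Set
InOS d S (γ₁ , γ₂) with wK d
... | (w₁ , w₂) =
  ∃[ a ] ∃[ b ] ∃[ c ] (InT S c ×
     (ℕ→ℚ c ℚ.* γ₁ ≡ ℤ→ℚ a ℚ.+ ℤ→ℚ b ℚ.* w₁) ×
     (ℕ→ℚ c ℚ.* γ₂ ≡ ℤ→ℚ b ℚ.* w₂))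

-- remove all factors p from n (fuel-bounded; fuel n suffices for p ≥ 2)
stripPrimeF : ℕ → ℕ → ℕ → ℕ
stripPrimeF zero p n = n
stripPrimeF (suc f) zero n = n
stripPrimeF (suc f) (suc q) n with suc q ∣? n
... | yes _ = stripPrimeF f (suc q) (n / suc q)
... | no  _ = n

stripPrime : ℕ → ℕ → ℕ
stripPrime p n = stripPrimeF n p n

stripS : List ℕ → ℕ → ℕ
stripS S n = foldr stripPrime n S

-- N_S(0) = 0 automatically.
-- (stripS S of a positive number is positive, so suc ∘ pred is the identity here.)
NS : List ℕ → ℚ → ℚ
NS S q = (+ stripS S ℤ.∣ ↥ q ∣) ℚ./ suc (ℕ.pred (stripS S (↧ₙ q)))

SNormEuclidean : ℕ → List ℕ → Set
SNormEuclidean d S = ∀ (ξ : K) → ∃[ γ ] (InOS d S γ × NS S (normK d (ξ -K γ)) ℚ.< 1ℚ)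

-- r ∈ I_j^k = ((j - √(3/D))/k , (j + √(3/D))/k)  (k ≥ 1)
--   iff |k r - j| < √(3/D)  iff  D (k r - j)² < 3
InInterval : ℕ → ℕ → ℕ → ℚ → Set
InInterval D k j r = ℕ→ℚ D ℚ.* (t ℚ.* t) ℚ.< ℕ→ℚ 3
  where t = ℕ→ℚ k ℚ.* r ℚ.- ℕ→ℚ j

Covered : ℕ → List ℕ → Set
Covered D S = ∀ (r : ℚ) → 0ℚ ℚ.≤ r → r ℚ.≤ 1ℚ →
  ∃[ k ] (InT S k × ∃[ j ] (j ℕ.≤ k × InInterval D k j r))

{-# OPTIONS --safe #-}
-- Write ξ = (A + B √-d) / P and split P = L m into its S-free part L and m ∈ T.
-- Covering (B mod L) / L by some I_j^k gives k ∈ T and b ∈ ℤ with D (k B - b L)² < 3 L²,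
-- and rounding gives a ∈ ℤ such that, for γ = (a + b w) / (k m) ∈ O_S, the integer
-- N = (k m L)² N(ξ - γ) satisfies 4 N ≤ L² + D (k B - b L)² < 4 L² (when -d ≡ 1 mod 4
-- one approximates 2B instead, because of the denominator of w).  Since k m ∈ T and L is
-- S-free, N_S(ξ - γ) = N_S(N) / L² ≤ N / L² < 1.

module Submission where

open import Defs

module S-Parts where

  open import Data.Nat as ℕ using (ℕ; zero; suc; _*_; _^_; _≤_; _<_; z≤n; s≤s; 2+; n>1⇒nonTrivial; nonTrivial⇒n>1)
  open import Data.Nat.Properties
  open import Data.Nat.Divisibility
  open import Data.Nat.DivMod using (_/_; m*[n/m]≡n; m/n<m; m≥n⇒m/n>0)
  open import Data.Nat.Primality
  open import Data.Nat.Coprimality using (Coprime; coprime-divisor)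
  open import Data.Nat.Induction using (<-rec)
  open import Data.List using (List; []; _∷_)
  open import Data.List.Membership.Propositional using (_∈_)
  open import Data.List.Relation.Unary.All as All using ([]; _∷_)
  open import Data.List.Relation.Unary.Any using (here; there)
  open import Data.Product using (_×_; ∃-syntax; _,_)
  open import Data.Sum using (inj₁; inj₂)
  open import Data.Empty using (⊥-elim)
  open import Algebra.Properties.CommutativeSemigroup *-commutativeSemigroup using (x∙yz≈y∙xz)
  open import Relation.Binary.PropositionalEquality
  open import Relation.Nullary using (yes; no; ¬_)

  SFree : List ℕ → ℕ → Set
  SFree S r = ∀ {p} → p ∈ S → ¬ p ∣ r

  ∃-prime-divisor : ∀ n → 1 < n → ∃[ p ] (Prime p × p ∣ n)
  ∃-prime-divisor = <-rec _ go
    where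
    go : ∀ n → (∀ {m} → m < n → 1 < m → ∃[ p ] (Prime p × p ∣ m)) → 1 < n → ∃[ p ] (Prime p × p ∣ n)
    go n rec 1<n with prime? n
    ... | yes n-prime = n , n-prime , ∣-refl
    ... | no n-composite with ¬prime⇒composite {{n>1⇒nonTrivial 1<n}} n-composite
    ... | hasNonTrivialDivisor {d} d<n d∣n with rec d<n (nonTrivial⇒n>1 d)
    ... | p , p-prime , p∣d = p , p-prime , ∣-trans p∣d d∣n

  InT-1 : ∀ {S} → InT S 1
  InT-1 = s≤s z≤n , λ p p-prime p∣1 → ⊥-elim (¬prime[1] (subst Prime (∣1⇒≡1 p∣1) p-prime))

  InT-* : ∀ {S a b} → InT S a → InT S b → InT S (a * b)
  InT-* {S} {a} {b} (0<a , a∈T) (0<b , b∈T) = *-mono-≤ 0<a 0<b , factors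
    where
    factors : ∀ p → Prime p → p ∣ a * b → p ∈ S
    factors p p-prime p∣ab with euclidsLemma a b p-prime p∣ab
    ... | inj₁ p∣a = a∈T p p-prime p∣a
    ... | inj₂ p∣b = b∈T p p-prime p∣b

  InT-prime : ∀ {S p} → Prime p → p ∈ S → InT S p
  InT-prime {S} {p} p-prime p∈S = ℕ.>-nonZero⁻¹ p {{prime⇒nonZero p-prime}} , factors
    where
    factors : ∀ q → Prime q → q ∣ p → q ∈ S
    factors q q-prime q∣p with prime⇒irreducible p-prime q∣p
    ... | inj₁ refl = ⊥-elim (¬prime[1] q-prime)
    ... | inj₂ refl = p∈S

  InT-^ : ∀ {S p} → Prime p → p ∈ S → ∀ i → InT S (p ^ i)
  InT-^ p-prime p∈S zero    = InT-1
  InT-^ p-prime p∈S (suc i) = InT-* (InT-prime p-prime p∈S) (InT-^ p-prime p∈S i)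

  SFree-* : ∀ {S a b} → PrimeSet S → SFree S a → SFree S b → SFree S (a * b)
  SFree-* {a = a} {b} S-primes a-free b-free p∈S p∣ab with euclidsLemma a b (All.lookup S-primes p∈S) p∣ab
  ... | inj₁ p∣a = a-free p∈S p∣a
  ... | inj₂ p∣b = b-free p∈S p∣b

  SFree∧InT⇒coprime : ∀ {S r t} → SFree S r → InT S t → Coprime r t
  SFree∧InT⇒coprime r-free (0<t , t∈T) {0} (_ , 0∣t) = ⊥-elim (<⇒≢ 0<t (sym (0∣⇒≡0 0∣t)))
  SFree∧InT⇒coprime r-free (0<t , t∈T) {1} _ = refl
  SFree∧InT⇒coprime r-free (0<t , t∈T) {2+ k} (i∣r , i∣t)
    with ∃-prime-divisor (2+ k) (s≤s (s≤s z≤n))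
  ... | p , p-prime , p∣i = ⊥-elim (r-free (t∈T p p-prime (∣-trans p∣i i∣t)) (∣-trans p∣i i∣r))

  SFree-part-unique : ∀ {S r t r′ t′} → SFree S r → SFree S r′ → InT S t → InT S t′ →
    r * t ≡ r′ * t′ → r ≡ r′
  SFree-part-unique {r = r} {t} {r′} {t′} r-free r′-free t∈T t′∈T eq = ∣-antisym r∣r′ r′∣r
    where
    r∣r′ : r ∣ r′
    r∣r′ = coprime-divisor (SFree∧InT⇒coprime r-free t′∈T)
      (subst (r ∣_) (trans eq (*-comm r′ t′)) (m∣m*n t))
    r′∣r : r′ ∣ r
    r′∣r = coprime-divisor (SFree∧InT⇒coprime r′-free t∈T)
      (subst (r′ ∣_) (trans (sym eq) (*-comm r t)) (m∣m*n t′))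

  0<m*n⇒0<m : ∀ {m n} → 0 < m * n → 0 < m
  0<m*n⇒0<m {suc m} _ = s≤s z≤n

  stripPrimeF-spec : ∀ f q {n} → 0 < n → n ≤ f →
    let p = 2+ q ; r = stripPrimeF f p n in ¬ p ∣ r × ∃[ i ] n ≡ r * p ^ i
  stripPrimeF-spec zero    q 0<n n≤0 = ⊥-elim (<⇒≱ 0<n n≤0)
  stripPrimeF-spec (suc f) q {n} 0<n n≤1+f with 2+ q ∣? n
  ... | no  p∤n = p∤n , 0 , sym (*-identityʳ n)
  ... | yes p∣n with stripPrimeF-spec f q (m≥n⇒m/n>0 (∣⇒≤ {{ℕ.>-nonZero 0<n}} p∣n))
                       (≤-pred (≤-trans (m/n<m n (2+ q) {{ℕ.>-nonZero 0<n}} (s≤s (s≤s z≤n))) n≤1+f))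
  ...   | p∤r , i , n/p≡r*pⁱ = p∤r , suc i , (begin
    n                    ≡⟨ m*[n/m]≡n p∣n ⟨
    p * (n / p)          ≡⟨ cong (p *_) n/p≡r*pⁱ ⟩
    p * (r * p ^ i)      ≡⟨ x∙yz≈y∙xz p r (p ^ i) ⟩
    r * (p * p ^ i)      ∎)
    where
    open ≡-Reasoning
    p = 2+ q
    r = stripPrimeF f p (n / p)

  InT-∷ : ∀ {S p t} → InT S t → InT (p ∷ S) t
  InT-∷ (0<t , t∈T) = 0<t , λ q q-prime q∣t → there (t∈T q q-prime q∣t)

  stripS-decomposition : ∀ {S} → PrimeSet S → ∀ {n} → 0 < n →
    SFree S (stripS S n) × ∃[ t ] (InT S t × n ≡ stripS S n * t)
  stripS-decomposition [] {n} _ = (λ ()) , 1 , InT-1 , sym (*-identityʳ n)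
  stripS-decomposition {0 ∷ _} (0-prime ∷ _) _ = ⊥-elim (¬prime[0] 0-prime)
  stripS-decomposition {1 ∷ _} (1-prime ∷ _) _ = ⊥-elim (¬prime[1] 1-prime)
  stripS-decomposition {2+ q ∷ S} (p-prime ∷ S-primes) {n} 0<n
    with stripS-decomposition S-primes 0<n
  ... | m-free , t , t∈T , n≡m*t
    with stripPrimeF-spec (stripS S n) q (0<m*n⇒0<m (subst (0 <_) n≡m*t 0<n)) ≤-refl
  ...   | p∤r , i , m≡r*pⁱ = r-free , p ^ i * t , InT-* (InT-^ p-prime (here refl) i) (InT-∷ t∈T) , (begin
    n                ≡⟨ n≡m*t ⟩
    m * t            ≡⟨ cong (_* t) m≡r*pⁱ ⟩
    r * p ^ i * t    ≡⟨ *-assoc r (p ^ i) t ⟩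
    r * (p ^ i * t)  ∎)
    where
    open ≡-Reasoning
    p = 2+ q
    m = stripS S n
    r = stripPrimeF m p m
    r-free : SFree (p ∷ S) r
    r-free (here refl) = p∤r
    r-free (there p′∈S) p′∣r = m-free p′∈S (∣-trans p′∣r (subst (r ∣_) (sym m≡r*pⁱ) (m∣m*n (p ^ i))))

  stripS-pos : ∀ {S} → PrimeSet S → ∀ {n} → 0 < n → 0 < stripS S n
  stripS-pos S-primes 0<n with stripS-decomposition S-primes 0<n
  ... | _ , _ , _ , n≡r*t = 0<m*n⇒0<m (subst (0 <_) n≡r*t 0<n)

  stripS-0 : ∀ S → stripS S 0 ≡ 0
  stripS-0 []      = refl
  stripS-0 (p ∷ S) rewrite stripS-0 S = refl

  -- Uniqueness of S-free parts turns n (c M) = N e into n_S M = N_S e_S, and N_S ≤ N < M.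
  stripS-< : ∀ {S} → PrimeSet S → ∀ {n e N c M} → InT S c → SFree S M → N < M → 0 < e →
    n * (c * M) ≡ N * e → stripS S n < stripS S e
  stripS-< {S} S-primes {zero} {e} _ _ _ 0<e _ rewrite stripS-0 S = stripS-pos S-primes 0<e
  stripS-< {S} S-primes {n@(suc _)} {e} {N} {c} {M} c∈T@(0<c , _) M-free N<M 0<e eq
    with stripS-decomposition S-primes {n} (s≤s z≤n)
       | stripS-decomposition S-primes 0<e
       | stripS-decomposition S-primes 0<N
    where
    0<N : 0 < N
    0<N = 0<m*n⇒0<m (subst (0 <_) eq (*-mono-≤ {1} {n} (s≤s z≤n) (*-mono-≤ 0<c (m<n⇒0<n N<M))))
  ... | n-free , tn , tn∈T , n≡ | e-free , te , te∈T , e≡ | N-free , tN , tN∈T@(0<tN , _) , N≡ =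
    *-cancelʳ-< M sn se (begin-strict
      sn * M   ≡⟨ SFree-part-unique (SFree-* S-primes n-free M-free) (SFree-* S-primes N-free e-free)
                    (InT-* tn∈T c∈T) (InT-* tN∈T te∈T) cleared ⟩
      sN * se  ≤⟨ *-monoˡ-≤ se (m≤m*n sN tN {{ℕ.>-nonZero 0<tN}}) ⟩
      sN * tN * se ≡⟨ cong (_* se) N≡ ⟨
      N * se   <⟨ *-monoˡ-< se {{ℕ.>-nonZero (stripS-pos S-primes 0<e)}} N<M ⟩
      M * se   ≡⟨ *-comm M se ⟩
      se * M   ∎)
    where
    open ≤-Reasoning
    sn = stripS S n
    se = stripS S e
    sN = stripS S N
    cleared : (sn * M) * (tn * c) ≡ (sN * se) * (tN * te)
    cleared = begin-equality
      (sn * M) * (tn * c)   ≡⟨ [m*n]*[o*p]≡[m*o]*[n*p] sn M tn c ⟩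
      (sn * tn) * (M * c)   ≡⟨ cong₂ _*_ n≡ (*-comm c M) ⟨
      n * (c * M)           ≡⟨ eq ⟩
      N * e                 ≡⟨ cong₂ _*_ N≡ e≡ ⟩
      (sN * tN) * (se * te) ≡⟨ [m*n]*[o*p]≡[m*o]*[n*p] sN tN se te ⟩
      (sN * se) * (tN * te) ∎

module Rationals where

  open S-Parts
  open import Data.Nat as ℕ using (ℕ; suc; NonZero; z≤n; s≤s)
  import Data.Nat.Properties as ℕ
  open import Data.Nat.Coprimality as Coprime using ()
  open import Data.Integer as ℤ using (ℤ; +_; +[1+_]; -[1+_]; +<+)
  import Data.Integer.Properties as ℤ
  open import Data.Rational as ℚ using (ℚ; mkℚ; ↥_; ↧_; ↧ₙ_; 1ℚ; _+_; _*_; _-_; _<_; *<*; Positive; toℚᵘ)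
  open import Data.Rational.Properties as ℚ using ()
  open import Data.Rational.Unnormalised as ℚᵘ using (mkℚᵘ; *≡*)
  import Data.Rational.Unnormalised.Properties as ℚᵘ
  open import Relation.Binary.PropositionalEquality

  coprime-to-1 : ∀ z → Coprime.Coprime ℤ.∣ z ∣ 1
  coprime-to-1 z = Coprime.sym (Coprime.1-coprimeTo ℤ.∣ z ∣)

  -- ℤ→ℚ z is in normal form, so rewriting it as mkℚ lets _+_, _*_ and _<_ on ℚ compute.
  ℤ→ℚ≡mkℚ : ∀ z → ℤ→ℚ z ≡ mkℚ z 0 (coprime-to-1 z)
  ℤ→ℚ≡mkℚ z = ℚ.↥p/↧p≡p (mkℚ z 0 (coprime-to-1 z))

  ℤ→ℚ-+ : ∀ a b → ℤ→ℚ (a ℤ.+ b) ≡ ℤ→ℚ a + ℤ→ℚ b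
  ℤ→ℚ-+ a b = trans (ℚ./-cong (sym (cong₂ ℤ._+_ (ℤ.*-identityʳ a) (ℤ.*-identityʳ b))) refl)
                    (sym (cong₂ _+_ (ℤ→ℚ≡mkℚ a) (ℤ→ℚ≡mkℚ b)))

  ℤ→ℚ-* : ∀ a b → ℤ→ℚ (a ℤ.* b) ≡ ℤ→ℚ a * ℤ→ℚ b
  ℤ→ℚ-* a b = sym (cong₂ _*_ (ℤ→ℚ≡mkℚ a) (ℤ→ℚ≡mkℚ b))

  ℕ→ℚ-* : ∀ m n → ℕ→ℚ (m ℕ.* n) ≡ ℕ→ℚ m * ℕ→ℚ n
  ℕ→ℚ-* m n = trans (cong ℤ→ℚ (ℤ.pos-* m n)) (ℤ→ℚ-* (+ m) (+ n))

  ℤ→ℚ-neg : ∀ a → ℤ→ℚ (ℤ.- a) ≡ ℚ.- ℤ→ℚ a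
  ℤ→ℚ-neg a = trans (ℤ→ℚ≡mkℚ (ℤ.- a)) (trans (neg-mkℚ a) (cong ℚ.-_ (sym (ℤ→ℚ≡mkℚ a))))
    where
    neg-mkℚ : ∀ a → mkℚ (ℤ.- a) 0 (coprime-to-1 (ℤ.- a)) ≡ ℚ.- mkℚ a 0 (coprime-to-1 a)
    neg-mkℚ (+ 0)     = refl
    neg-mkℚ +[1+ n ]  = refl
    neg-mkℚ -[1+ n ]  = refl

  ℤ→ℚ-minus : ∀ a b → ℤ→ℚ (a ℤ.- b) ≡ ℤ→ℚ a - ℤ→ℚ b
  ℤ→ℚ-minus a b = trans (ℤ→ℚ-+ a (ℤ.- b)) (cong (λ q → ℤ→ℚ a + q) (ℤ→ℚ-neg b))

  ℤ→ℚ[ab-cd] : ∀ a b c d → ℤ→ℚ (a ℤ.* b ℤ.- c ℤ.* d) ≡ ℤ→ℚ a * ℤ→ℚ b - ℤ→ℚ c * ℤ→ℚ d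
  ℤ→ℚ[ab-cd] a b c d = trans (ℤ→ℚ-minus (a ℤ.* b) (c ℤ.* d)) (cong₂ _-_ (ℤ→ℚ-* a b) (ℤ→ℚ-* c d))

  ℤ→ℚ-mono-< : ∀ {a b} → a ℤ.< b → ℤ→ℚ a < ℤ→ℚ b
  ℤ→ℚ-mono-< {a} {b} a<b = subst₂ _<_ (sym (ℤ→ℚ≡mkℚ a)) (sym (ℤ→ℚ≡mkℚ b))
    (*<* (subst₂ ℤ._<_ (sym (ℤ.*-identityʳ a)) (sym (ℤ.*-identityʳ b)) a<b))

  ℤ→ℚ-cancel-< : ∀ {a b} → ℤ→ℚ a < ℤ→ℚ b → a ℤ.< b
  ℤ→ℚ-cancel-< {a} {b} lt with subst₂ _<_ (ℤ→ℚ≡mkℚ a) (ℤ→ℚ≡mkℚ b) lt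
  ... | *<* a*1<b*1 = subst₂ ℤ._<_ (ℤ.*-identityʳ a) (ℤ.*-identityʳ b) a*1<b*1

  z/n*n≡z : ∀ z n .{{_ : NonZero n}} → (z ℚ./ n) * ℕ→ℚ n ≡ ℤ→ℚ z
  z/n*n≡z z (suc k) = ℚ.toℚᵘ-injective (begin
    toℚᵘ ((z ℚ./ suc k) * ℕ→ℚ (suc k))         ≈⟨ ℚ.toℚᵘ-homo-* (z ℚ./ suc k) (ℕ→ℚ (suc k)) ⟩
    toℚᵘ (z ℚ./ suc k) ℚᵘ.* toℚᵘ (ℕ→ℚ (suc k)) ≈⟨ ℚᵘ.*-cong (ℚ.toℚᵘ-fromℚᵘ (mkℚᵘ z k)) (ℚ.toℚᵘ-fromℚᵘ (mkℚᵘ (+ suc k) 0)) ⟩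
    mkℚᵘ z k ℚᵘ.* mkℚᵘ (+ suc k) 0              ≈⟨ *≡* (trans (ℤ.*-identityʳ _) (cong (λ m → z ℤ.* + m) (sym (ℕ.*-identityʳ (suc k))))) ⟩
    mkℚᵘ z 0                                    ≈⟨ ℚ.toℚᵘ-fromℚᵘ (mkℚᵘ z 0) ⟨
    toℚᵘ (ℤ→ℚ z)                                ∎)
    where open ℚᵘ.≃-Reasoning

  p*↧p≡↥p : ∀ p → p * ℤ→ℚ (↧ p) ≡ ℤ→ℚ (↥ p)
  p*↧p≡↥p p@(mkℚ n d _) = trans (cong (_* ℤ→ℚ (↧ p)) (sym (ℚ.↥p/↧p≡p p))) (z/n*n≡z n (suc d))

  *-common-denominator : ∀ p q → p * ℕ→ℚ (↧ₙ p ℕ.* ↧ₙ q) ≡ ℤ→ℚ (↥ p ℤ.* ↧ q)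
  *-common-denominator p q = begin
    p * ℕ→ℚ (↧ₙ p ℕ.* ↧ₙ q)            ≡⟨ cong (p *_) (ℕ→ℚ-* (↧ₙ p) (↧ₙ q)) ⟩
    p * (ℤ→ℚ (↧ p) * ℤ→ℚ (↧ q))        ≡⟨ ℚ.*-assoc p (ℤ→ℚ (↧ p)) (ℤ→ℚ (↧ q)) ⟨
    p * ℤ→ℚ (↧ p) * ℤ→ℚ (↧ q)          ≡⟨ cong (_* ℤ→ℚ (↧ q)) (p*↧p≡↥p p) ⟩
    ℤ→ℚ (↥ p) * ℤ→ℚ (↧ q)              ≡⟨ ℤ→ℚ-* (↥ p) (↧ q) ⟨
    ℤ→ℚ (↥ p ℤ.* ↧ q)                  ∎
    where open ≡-Reasoning

  cross-multiply : ∀ q {m z} → q * ℤ→ℚ m ≡ ℤ→ℚ z → ↥ q ℤ.* m ≡ z ℤ.* ↧ q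
  cross-multiply q@(mkℚ _ d _) {m} {z} eq = cleared (begin
    toℚᵘ q ℚᵘ.* mkℚᵘ m 0          ≈⟨ ℚᵘ.*-congˡ {toℚᵘ q} (ℚ.toℚᵘ-fromℚᵘ (mkℚᵘ m 0)) ⟨
    toℚᵘ q ℚᵘ.* toℚᵘ (ℤ→ℚ m)     ≈⟨ ℚ.toℚᵘ-homo-* q (ℤ→ℚ m) ⟨
    toℚᵘ (q * ℤ→ℚ m)             ≈⟨ ℚ.toℚᵘ-cong eq ⟩
    toℚᵘ (ℤ→ℚ z)                 ≈⟨ ℚ.toℚᵘ-fromℚᵘ (mkℚᵘ z 0) ⟩
    mkℚᵘ z 0                     ∎)
    where
    open ℚᵘ.≃-Reasoning
    cleared : toℚᵘ q ℚᵘ.* mkℚᵘ m 0 ℚᵘ.≃ mkℚᵘ z 0 → ↥ q ℤ.* m ≡ z ℤ.* ↧ q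
    cleared (*≡* eq′) = trans (sym (ℤ.*-identityʳ _)) (trans eq′ (cong (λ n → z ℤ.* + n) (ℕ.*-identityʳ (suc d))))

  ℕ→ℚ-pos : ∀ n .{{_ : NonZero n}} → Positive (ℕ→ℚ n)
  ℕ→ℚ-pos n = ℚ.normalize-pos n 1

  *-cancelʳ-≡-pos : ∀ {p q} r .{{_ : Positive r}} → p * r ≡ q * r → p ≡ q
  *-cancelʳ-≡-pos r eq =
    ℚ.≤-antisym (ℚ.*-cancelʳ-≤-pos r (ℚ.≤-reflexive eq)) (ℚ.*-cancelʳ-≤-pos r (ℚ.≤-reflexive (sym eq)))

  +m/n<1 : ∀ {m n} .{{_ : NonZero n}} → m ℕ.< n → (+ m) ℚ./ n < 1ℚ
  +m/n<1 {m} {n} m<n = ℚ.*-cancelʳ-<-nonNeg (ℕ→ℚ n) {{ℚ.pos⇒nonNeg (ℕ→ℚ n) {{ℕ→ℚ-pos n}}}} {(+ m) ℚ./ n} {1ℚ} (begin-strict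
    ((+ m) ℚ./ n) * ℕ→ℚ n  ≡⟨ z/n*n≡z (+ m) n ⟩
    ℕ→ℚ m                  <⟨ ℤ→ℚ-mono-< (+<+ m<n) ⟩
    ℕ→ℚ n                  ≡⟨ ℚ.*-identityˡ (ℕ→ℚ n) ⟨
    1ℚ * ℕ→ℚ n             ∎)
    where open ℚ.≤-Reasoning

  NS<1 : ∀ {S} → PrimeSet S → ∀ q {c M z} → InT S c → SFree S M → ℤ.∣ z ∣ ℕ.< M →
    q * ℕ→ℚ (c ℕ.* M) ≡ ℤ→ℚ z → NS S q < 1ℚ
  NS<1 S-primes q@(mkℚ n d _) {c} {M} {z} c∈T M-free ∣z∣<M eq =
    /suc-pred<1 (stripS-< S-primes c∈T M-free ∣z∣<M (s≤s z≤n) ∣n∣cM≡∣z∣d)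
    where
    /suc-pred<1 : ∀ {a b} → a ℕ.< b → (+ a) ℚ./ suc (ℕ.pred b) < 1ℚ
    /suc-pred<1 {b = suc _} = +m/n<1
    ∣n∣cM≡∣z∣d : ℤ.∣ n ∣ ℕ.* (c ℕ.* M) ≡ ℤ.∣ z ∣ ℕ.* suc d
    ∣n∣cM≡∣z∣d = trans (sym (ℤ.abs-* n (+ (c ℕ.* M))))
                   (trans (cong ℤ.∣_∣ (cross-multiply q {+ (c ℕ.* M)} {z} eq)) (ℤ.abs-* z (+ suc d)))

module IntegerEstimates where

  open import Data.Nat as ℕ using (ℕ; zero; suc; NonZero)
  import Data.Nat.Properties as ℕ
  open import Data.Integer as ℤ using (ℤ; +_; -[1+_]; _⊖_)
  import Data.Integer.Properties as ℤ
  open import Data.Integer.DivMod using (_/ℕ_; _%ℕ_; a≡a%ℕn+[a/ℕn]*n; n%ℕd<d)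
  open import Data.Integer.Tactic.RingSolver using (solve-∀)
  open import Data.Product using (∃-syntax; _,_)
  open import Relation.Binary.PropositionalEquality
  open import Relation.Nullary using (yes; no)

  i*i≡∣i∣*∣i∣ : ∀ i → i ℤ.* i ≡ + (ℤ.∣ i ∣ ℕ.* ℤ.∣ i ∣)
  i*i≡∣i∣*∣i∣ (+ n)    = sym (ℤ.pos-* n n)
  i*i≡∣i∣*∣i∣ -[1+ n ] = refl

  ∣m⊖n∣≤n : ∀ {m n} → m ℕ.< n ℕ.+ n → ℤ.∣ m ⊖ n ∣ ℕ.≤ n
  ∣m⊖n∣≤n {m} {zero} ()
  ∣m⊖n∣≤n {m} {n@(suc _)} m<n+n with m ℕ.≤? n
  ... | yes m≤n = subst (ℕ._≤ n) (sym (ℤ.∣⊖∣-≤ m≤n)) (ℕ.m∸n≤m n m)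
  ... | no  m≰n = subst (ℕ._≤ n) (sym (cong ℤ.∣_∣ (ℤ.⊖-≥ (ℕ.<⇒≤ (ℕ.≰⇒> m≰n)))))
                    (ℕ.<⇒≤ (ℕ.m<n+o⇒m∸n<o m n m<n+n))

  round-to-multiple : ∀ F L .{{_ : NonZero L}} → ∃[ a ] ℤ.∣ F ℤ.- a ℤ.* (+ 2 ℤ.* + L) ∣ ℕ.≤ L
  round-to-multiple F L = a , subst (λ u → ℤ.∣ u ∣ ℕ.≤ L) (sym u≡ρ⊖L) (∣m⊖n∣≤n (n%ℕd<d E (L ℕ.+ L)))
    where
    instance
      2L-nonZero : NonZero (L ℕ.+ L)
      2L-nonZero = ℕ.>-nonZero (ℕ.+-mono-< (ℕ.>-nonZero⁻¹ L) (ℕ.>-nonZero⁻¹ L))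
    E = F ℤ.+ + L
    ρ = E %ℕ (L ℕ.+ L)
    a = E /ℕ (L ℕ.+ L)
    shift : ∀ F a L → F ℤ.- a ℤ.* (+ 2 ℤ.* L) ≡ (F ℤ.+ L) ℤ.- a ℤ.* (L ℤ.+ L) ℤ.- L
    shift = solve-∀
    cancel : ∀ r x L → r ℤ.+ x ℤ.- x ℤ.- L ≡ r ℤ.- L
    cancel = solve-∀
    u≡ρ⊖L : F ℤ.- a ℤ.* (+ 2 ℤ.* + L) ≡ ρ ⊖ L
    u≡ρ⊖L = begin
      F ℤ.- a ℤ.* (+ 2 ℤ.* + L)                        ≡⟨ shift F a (+ L) ⟩
      E ℤ.- a ℤ.* (+ L ℤ.+ + L) ℤ.- + L                ≡⟨ cong (λ e → e ℤ.- a ℤ.* (+ L ℤ.+ + L) ℤ.- + L)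
                                                            (trans (a≡a%ℕn+[a/ℕn]*n E (L ℕ.+ L))
                                                                   (cong (λ d → + ρ ℤ.+ a ℤ.* d) (ℤ.pos-+ L L))) ⟩
      + ρ ℤ.+ a ℤ.* (+ L ℤ.+ + L) ℤ.- a ℤ.* (+ L ℤ.+ + L) ℤ.- + L ≡⟨ cancel (+ ρ) (a ℤ.* (+ L ℤ.+ + L)) (+ L) ⟩
      + ρ ℤ.- + L                                      ≡⟨ ℤ.m-n≡m⊖n ρ L ⟩
      ρ ⊖ L                                            ∎
      where open ≡-Reasoning

  norm-bound : ∀ D {L} N u T → + 4 ℤ.* N ≡ u ℤ.* u ℤ.+ + D ℤ.* (T ℤ.* T) → ℤ.∣ u ∣ ℕ.≤ L →
    + D ℤ.* (T ℤ.* T) ℤ.< + 3 ℤ.* (+ L ℤ.* + L) → ℤ.∣ N ∣ ℕ.< L ℕ.* L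
  norm-bound D {L} N u T 4N≡ ∣u∣≤L DT²<3L² = ℕ.*-cancelˡ-< 4 _ _ (begin-strict
    4 ℕ.* ℤ.∣ N ∣                   ≡⟨ ℤ.abs-* (+ 4) N ⟨
    ℤ.∣ + 4 ℤ.* N ∣                 ≡⟨ cong ℤ.∣_∣ (trans 4N≡ sum≡) ⟩
    ∣u∣ ℕ.* ∣u∣ ℕ.+ D ℕ.* (∣T∣ ℕ.* ∣T∣) <⟨ ℕ.+-mono-≤-< (ℕ.*-mono-≤ ∣u∣≤L ∣u∣≤L) (ℤ.drop‿+<+ DT²<3L²′) ⟩
    L ℕ.* L ℕ.+ 3 ℕ.* (L ℕ.* L)     ≡⟨⟩
    4 ℕ.* (L ℕ.* L)                 ∎)
    where
    open ℕ.≤-Reasoning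
    ∣u∣ = ℤ.∣ u ∣
    ∣T∣ = ℤ.∣ T ∣
    DT²≡ : + D ℤ.* (T ℤ.* T) ≡ + (D ℕ.* (∣T∣ ℕ.* ∣T∣))
    DT²≡ = trans (cong (+ D ℤ.*_) (i*i≡∣i∣*∣i∣ T)) (sym (ℤ.pos-* D (∣T∣ ℕ.* ∣T∣)))
    sum≡ : u ℤ.* u ℤ.+ + D ℤ.* (T ℤ.* T) ≡ + (∣u∣ ℕ.* ∣u∣ ℕ.+ D ℕ.* (∣T∣ ℕ.* ∣T∣))
    sum≡ = trans (cong₂ ℤ._+_ (i*i≡∣i∣*∣i∣ u) DT²≡) (sym (ℤ.pos-+ (∣u∣ ℕ.* ∣u∣) (D ℕ.* (∣T∣ ℕ.* ∣T∣))))
    DT²<3L²′ : + (D ℕ.* (∣T∣ ℕ.* ∣T∣)) ℤ.< + (3 ℕ.* (L ℕ.* L))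
    DT²<3L²′ = subst₂ ℤ._<_ DT²≡ (trans (cong (+ 3 ℤ.*_) (sym (ℤ.pos-* L L))) (sym (ℤ.pos-* 3 (L ℕ.* L)))) DT²<3L²

module Approximation where

  open S-Parts
  open Rationals
  open IntegerEstimates
  open import Data.Nat using (NonZero)
  open import Data.Integer as ℤ using (ℤ; +_)
  open import Data.Integer.DivMod using (_/ℕ_; _%ℕ_; a≡a%ℕn+[a/ℕn]*n; n%ℕd<d)
  open import Data.Integer.Tactic.RingSolver using (solve-∀)
  open import Data.Rational as ℚ using (ℚ; 0ℚ; 1ℚ; _+_; _*_; _-_; _<_)
  open import Data.Rational.Properties as ℚ using ()
  open import Data.Rational.Solver using (module +-*-Solver)
  open import Data.Product using (_×_; ∃-syntax; _,_)
  open import Function using (case_of_)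
  open import Relation.Binary.PropositionalEquality

  open +-*-Solver

  InInterval-cleared : ∀ {D k j ρ L} .{{_ : NonZero L}} → InInterval D k j ((+ ρ) ℚ./ L) →
    let T = + k ℤ.* + ρ ℤ.- + j ℤ.* + L in + D ℤ.* (T ℤ.* T) ℤ.< + 3 ℤ.* (+ L ℤ.* + L)
  InInterval-cleared {D} {k} {j} {ρ} {L} in-I = ℤ→ℚ-cancel-< (subst₂ _<_ lhs rhs
    (ℚ.*-monoˡ-<-pos (ℓ * ℓ) {{ℚ.pos*pos⇒pos ℓ {{ℕ→ℚ-pos L}} ℓ {{ℕ→ℚ-pos L}}}} in-I))
    where
    open ≡-Reasoning
    ℓ = ℕ→ℚ L
    T = + k ℤ.* + ρ ℤ.- + j ℤ.* + L
    t = ℕ→ℚ k * ((+ ρ) ℚ./ L) - ℕ→ℚ j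
    tℓ≡T : t * ℓ ≡ ℤ→ℚ T
    tℓ≡T = begin
      t * ℓ                                     ≡⟨ solve 4 (λ K R J L → (K :* R :- J) :* L := K :* (R :* L) :- J :* L)
                                                     refl (ℕ→ℚ k) ((+ ρ) ℚ./ L) (ℕ→ℚ j) ℓ ⟩
      ℕ→ℚ k * ((+ ρ) ℚ./ L * ℓ) - ℕ→ℚ j * ℓ    ≡⟨ cong (λ x → ℕ→ℚ k * x - ℕ→ℚ j * ℓ) (z/n*n≡z (+ ρ) L) ⟩
      ℕ→ℚ k * ℕ→ℚ ρ - ℕ→ℚ j * ℓ               ≡⟨ ℤ→ℚ[ab-cd] (+ k) (+ ρ) (+ j) (+ L) ⟨
      ℤ→ℚ T                                     ∎
    lhs : ℕ→ℚ D * (t * t) * (ℓ * ℓ) ≡ ℤ→ℚ (+ D ℤ.* (T ℤ.* T))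
    lhs = begin
      ℕ→ℚ D * (t * t) * (ℓ * ℓ)       ≡⟨ solve 3 (λ D t ℓ → D :* (t :* t) :* (ℓ :* ℓ) := D :* ((t :* ℓ) :* (t :* ℓ)))
                                           refl (ℕ→ℚ D) t ℓ ⟩
      ℕ→ℚ D * ((t * ℓ) * (t * ℓ))     ≡⟨ cong (λ x → ℕ→ℚ D * (x * x)) tℓ≡T ⟩
      ℕ→ℚ D * (ℤ→ℚ T * ℤ→ℚ T)        ≡⟨ trans (ℤ→ℚ-* (+ D) (T ℤ.* T)) (cong (ℕ→ℚ D *_) (ℤ→ℚ-* T T)) ⟨
      ℤ→ℚ (+ D ℤ.* (T ℤ.* T))         ∎
    rhs : ℕ→ℚ 3 * (ℓ * ℓ) ≡ ℤ→ℚ (+ 3 ℤ.* (+ L ℤ.* + L))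
    rhs = sym (trans (ℤ→ℚ-* (+ 3) (+ L ℤ.* + L)) (cong (ℕ→ℚ 3 *_) (ℤ→ℚ-* (+ L) (+ L))))

  -- b = k ⌊B / L⌋ + j, where I_j^k contains (B mod L) / L, so that |k B / L - b| < √(3 / D).
  covered⇒approximation : ∀ {D S} → Covered D S → ∀ B L .{{_ : NonZero L}} →
    ∃[ k ] (InT S k × ∃[ b ] (let T = + k ℤ.* B ℤ.- b ℤ.* + L in
                                + D ℤ.* (T ℤ.* T) ℤ.< + 3 ℤ.* (+ L ℤ.* + L)))
  covered⇒approximation {D} cov B L = case cov r 0≤r r≤1 of (λ where
    (k , k∈T , j , _ , in-I) → k , k∈T , + k ℤ.* q ℤ.+ + j ,
      subst (λ T → + D ℤ.* (T ℤ.* T) ℤ.< + 3 ℤ.* (+ L ℤ.* + L)) (sym (T≡ k j)) (InInterval-cleared {D} {k} {j} {ρ} in-I))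
    where
    ρ = B %ℕ L
    q = B /ℕ L
    r = (+ ρ) ℚ./ L
    0≤r : 0ℚ ℚ.≤ r
    0≤r = ℚ.nonNegative⁻¹ r {{ℚ.normalize-nonNeg ρ L}}
    r≤1 : r ℚ.≤ 1ℚ
    r≤1 = ℚ.<⇒≤ (+m/n<1 (n%ℕd<d B L))
    rearrange : ∀ k ρ q j L → k ℤ.* (ρ ℤ.+ q ℤ.* L) ℤ.- (k ℤ.* q ℤ.+ j) ℤ.* L ≡ k ℤ.* ρ ℤ.- j ℤ.* L
    rearrange = solve-∀
    T≡ : ∀ k j → + k ℤ.* B ℤ.- (+ k ℤ.* q ℤ.+ + j) ℤ.* + L ≡ + k ℤ.* + ρ ℤ.- + j ℤ.* + L
    T≡ k j = trans (cong (λ B → + k ℤ.* B ℤ.- (+ k ℤ.* q ℤ.+ + j) ℤ.* + L) (a≡a%ℕn+[a/ℕn]*n B L))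
                   (rearrange (+ k) (+ ρ) q (+ j) (+ L))

module ClearingDenominators where

  open S-Parts
  open Rationals
  open import Data.Nat as ℕ using (ℕ; NonZero)
  import Data.Nat.Properties as ℕ
  open import Data.Integer as ℤ using (ℤ; +_)
  open import Data.Rational as ℚ using (ℚ; 1ℚ; _+_; _*_; _-_; _<_)
  open import Data.Rational.Properties as ℚ using ()
  open import Data.Rational.Solver using (module +-*-Solver)
  open import Data.Product using (_,_)
  open import Data.Nat.Tactic.RingSolver using (solve-∀)
  open import Relation.Binary.PropositionalEquality

  open +-*-Solver

  clear-denominator : ∀ x γ A a P c k L → x * ℕ→ℚ P ≡ ℤ→ℚ A → γ * ℕ→ℚ c ≡ ℤ→ℚ a →
    k ℕ.* P ≡ c ℕ.* L → (x - γ) * ℕ→ℚ (c ℕ.* L) ≡ ℤ→ℚ (+ k ℤ.* A ℤ.- a ℤ.* + L)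
  clear-denominator x γ A a P c k L xP≡A γc≡a kP≡cL = begin
    (x - γ) * ℕ→ℚ (c ℕ.* L)                         ≡⟨ solve 3 (λ x γ Q → (x :- γ) :* Q := x :* Q :- γ :* Q) refl x γ (ℕ→ℚ (c ℕ.* L)) ⟩
    x * ℕ→ℚ (c ℕ.* L) - γ * ℕ→ℚ (c ℕ.* L)           ≡⟨ cong₂ (λ Q Q′ → x * Q - γ * Q′) (trans (cong ℕ→ℚ (sym kP≡cL)) (ℕ→ℚ-* k P)) (ℕ→ℚ-* c L) ⟩
    x * (ℕ→ℚ k * ℕ→ℚ P) - γ * (ℕ→ℚ c * ℕ→ℚ L)      ≡⟨ solve 6 (λ x γ k P c L → x :* (k :* P) :- γ :* (c :* L) := k :* (x :* P) :- (γ :* c) :* L)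
                                                          refl x γ (ℕ→ℚ k) (ℕ→ℚ P) (ℕ→ℚ c) (ℕ→ℚ L) ⟩
    ℕ→ℚ k * (x * ℕ→ℚ P) - (γ * ℕ→ℚ c) * ℕ→ℚ L      ≡⟨ cong₂ (λ u v → ℕ→ℚ k * u - v * ℕ→ℚ L) xP≡A γc≡a ⟩
    ℕ→ℚ k * ℤ→ℚ A - ℤ→ℚ a * ℕ→ℚ L                  ≡⟨ ℤ→ℚ[ab-cd] (+ k) A a (+ L) ⟨
    ℤ→ℚ (+ k ℤ.* A ℤ.- a ℤ.* + L)                   ∎
    where open ≡-Reasoning

  normK-scaled : ∀ d X Y Q u t → X * ℕ→ℚ Q ≡ ℤ→ℚ u → Y * ℕ→ℚ Q ≡ ℤ→ℚ t →
    normK d (X , Y) * ℕ→ℚ (Q ℕ.* Q) ≡ ℤ→ℚ (u ℤ.* u ℤ.+ + d ℤ.* (t ℤ.* t))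
  normK-scaled d X Y Q u t XQ≡u YQ≡t = begin
    normK d (X , Y) * ℕ→ℚ (Q ℕ.* Q)                           ≡⟨ cong (normK d (X , Y) *_) (ℕ→ℚ-* Q Q) ⟩
    (X * X + ℕ→ℚ d * (Y * Y)) * (ℕ→ℚ Q * ℕ→ℚ Q)               ≡⟨ solve 4 (λ X Y D Q → (X :* X :+ D :* (Y :* Y)) :* (Q :* Q)
                                                                    := (X :* Q) :* (X :* Q) :+ D :* ((Y :* Q) :* (Y :* Q)))
                                                                    refl X Y (ℕ→ℚ d) (ℕ→ℚ Q) ⟩
    (X * ℕ→ℚ Q) * (X * ℕ→ℚ Q) + ℕ→ℚ d * ((Y * ℕ→ℚ Q) * (Y * ℕ→ℚ Q)) ≡⟨ cong₂ (λ v w → v * v + ℕ→ℚ d * (w * w)) XQ≡u YQ≡t ⟩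
    ℤ→ℚ u * ℤ→ℚ u + ℕ→ℚ d * (ℤ→ℚ t * ℤ→ℚ t)                 ≡⟨ cong₂ _+_ (ℤ→ℚ-* u u) (trans (ℤ→ℚ-* (+ d) (t ℤ.* t)) (cong (ℕ→ℚ d *_) (ℤ→ℚ-* t t))) ⟨
    ℤ→ℚ (u ℤ.* u) + ℤ→ℚ (+ d ℤ.* (t ℤ.* t))                 ≡⟨ ℤ→ℚ-+ (u ℤ.* u) (+ d ℤ.* (t ℤ.* t)) ⟨
    ℤ→ℚ (u ℤ.* u ℤ.+ + d ℤ.* (t ℤ.* t))                     ∎
    where open ≡-Reasoning

  -- The extra factor e is the denominator 2 of w = (1 + √-d)/2 when -d ≡ 1 (mod 4).
  NS-normK<1 : ∀ {S} → PrimeSet S → ∀ d X Y {c} e c′ {L} u t N .{{_ : NonZero e}} → InT S c → SFree S L →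
    c′ ≡ e ℕ.* c → X * ℕ→ℚ (c′ ℕ.* L) ≡ ℤ→ℚ u → Y * ℕ→ℚ (c′ ℕ.* L) ≡ ℤ→ℚ t →
    u ℤ.* u ℤ.+ + d ℤ.* (t ℤ.* t) ≡ + (e ℕ.* e) ℤ.* N → ℤ.∣ N ∣ ℕ.< L ℕ.* L →
    NS S (normK d (X , Y)) < 1ℚ
  NS-normK<1 S-primes d X Y {c} e _ {L} u t N c∈T L-free refl Xs≡u Ys≡t norm≡ ∣N∣<L² =
    NS<1 S-primes n {c ℕ.* c} {L ℕ.* L} {N} (InT-* c∈T c∈T) (SFree-* S-primes L-free L-free) ∣N∣<L² cleared
    where
    open ≡-Reasoning
    n = normK d (X , Y)
    e² = ℕ→ℚ (e ℕ.* e)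
    rearrange : ∀ c e L → c ℕ.* c ℕ.* (L ℕ.* L) ℕ.* (e ℕ.* e) ≡ e ℕ.* c ℕ.* L ℕ.* (e ℕ.* c ℕ.* L)
    rearrange = solve-∀
    cleared : n * ℕ→ℚ (c ℕ.* c ℕ.* (L ℕ.* L)) ≡ ℤ→ℚ N
    cleared = *-cancelʳ-≡-pos e² {{ℕ→ℚ-pos (e ℕ.* e) {{ℕ.m*n≢0 e e}}}} (begin
      n * ℕ→ℚ (c ℕ.* c ℕ.* (L ℕ.* L)) * e²            ≡⟨ ℚ.*-assoc n (ℕ→ℚ (c ℕ.* c ℕ.* (L ℕ.* L))) e² ⟩
      n * (ℕ→ℚ (c ℕ.* c ℕ.* (L ℕ.* L)) * e²)          ≡⟨ cong (n *_) (trans (cong ℕ→ℚ (sym (rearrange c e L))) (ℕ→ℚ-* (c ℕ.* c ℕ.* (L ℕ.* L)) (e ℕ.* e))) ⟨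
      n * ℕ→ℚ (e ℕ.* c ℕ.* L ℕ.* (e ℕ.* c ℕ.* L))     ≡⟨ normK-scaled d X Y (e ℕ.* c ℕ.* L) u t Xs≡u Ys≡t ⟩
      ℤ→ℚ (u ℤ.* u ℤ.+ + d ℤ.* (t ℤ.* t))             ≡⟨ cong ℤ→ℚ norm≡ ⟩
      ℤ→ℚ (+ (e ℕ.* e) ℤ.* N)                         ≡⟨ ℤ→ℚ-* (+ (e ℕ.* e)) N ⟩
      e² * ℤ→ℚ N                                      ≡⟨ ℚ.*-comm e² (ℤ→ℚ N) ⟩
      ℤ→ℚ N * e²                                      ∎)

module EuclideanWitnesses where

  open S-Parts
  open Rationals
  open IntegerEstimates
  open Approximation
  open ClearingDenominators
  open import Data.Nat as ℕ using (ℕ; NonZero)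
  import Data.Nat.Properties as ℕ
  open import Data.Nat.DivMod using (_%_; _/_; m≡m%n+[m/n]*n)
  open import Data.Integer as ℤ using (ℤ; +_)
  import Data.Integer.Properties as ℤ
  open import Data.Rational as ℚ using (ℚ; 1ℚ; _+_; _*_; _-_; _<_)
  open import Data.Rational.Properties as ℚ using ()
  open import Data.Rational.Solver using (module +-*-Solver)
  open import Data.Product using (∃-syntax; _×_; _,_; proj₁)
  open import Data.Empty using (⊥-elim)
  open import Data.Integer.Tactic.RingSolver using (solve-∀)
  import Data.Nat.Tactic.RingSolver as ℕ-Ring
  open import Algebra.Properties.CommutativeSemigroup ℕ.*-commutativeSemigroup using (x∙yz≈xz∙y)
  open import Function using (case_of_)
  open import Relation.Binary.PropositionalEquality
  open import Relation.Nullary using (yes; no; ¬_)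

  open +-*-Solver

  discD-≡3 : ∀ d → d % 4 ≡ 3 → discD d ≡ d
  discD-≡3 d d≡3 with d % 4 ℕ.≟ 3
  ... | yes _   = refl
  ... | no  d≢3 = ⊥-elim (d≢3 d≡3)

  discD-≢3 : ∀ d → ¬ d % 4 ≡ 3 → discD d ≡ 4 ℕ.* d
  discD-≢3 d d≢3 with d % 4 ℕ.≟ 3
  ... | yes d≡3 = ⊥-elim (d≢3 d≡3)
  ... | no  _   = refl

  InOS-≢3 : ∀ {S} d γ₁ γ₂ a b {c} → ¬ d % 4 ≡ 3 → InT S c →
    ℕ→ℚ c * γ₁ ≡ ℤ→ℚ a → ℕ→ℚ c * γ₂ ≡ ℤ→ℚ b → InOS d S (γ₁ , γ₂)
  InOS-≢3 d γ₁ γ₂ a b {c} d≢3 c∈T cγ₁≡a cγ₂≡b with d % 4 ℕ.≟ 3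
  ... | yes d≡3 = ⊥-elim (d≢3 d≡3)
  ... | no  _   = a , b , c , c∈T ,
    trans cγ₁≡a (sym (trans (cong (λ z → ℤ→ℚ a + z) (ℚ.*-zeroʳ (ℤ→ℚ b))) (ℚ.+-identityʳ (ℤ→ℚ a)))) ,
    trans cγ₂≡b (sym (ℚ.*-identityʳ (ℤ→ℚ b)))

  ½ : ℚ
  ½ = (+ 1) ℚ./ 2

  2*½≡1 : ℕ→ℚ 2 * ½ ≡ 1ℚ
  2*½≡1 = trans (ℚ.*-comm (ℕ→ℚ 2) ½) (z/n*n≡z (+ 1) 2)

  *2≡⇒≡*½ : ∀ {p q} → p * ℕ→ℚ 2 ≡ q → p ≡ q * ½
  *2≡⇒≡*½ {p} {q} p2≡q = begin
    p                  ≡⟨ ℚ.*-identityʳ p ⟨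
    p * 1ℚ             ≡⟨ cong (p *_) 2*½≡1 ⟨
    p * (ℕ→ℚ 2 * ½)    ≡⟨ ℚ.*-assoc p (ℕ→ℚ 2) ½ ⟨
    p * ℕ→ℚ 2 * ½      ≡⟨ cong (_* ½) p2≡q ⟩
    q * ½              ∎
    where open ≡-Reasoning

  InOS-≡3 : ∀ {S} d γ₁ γ₂ a b {c} → d % 4 ≡ 3 → InT S c →
    ℕ→ℚ (2 ℕ.* c) * γ₁ ≡ ℤ→ℚ (+ 2 ℤ.* a ℤ.+ b) → ℕ→ℚ (2 ℕ.* c) * γ₂ ≡ ℤ→ℚ b → InOS d S (γ₁ , γ₂)
  InOS-≡3 d γ₁ γ₂ a b {c} d≡3 c∈T 2cγ₁≡2a+b 2cγ₂≡b with d % 4 ℕ.≟ 3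
  ... | no  d≢3 = ⊥-elim (d≢3 d≡3)
  ... | yes _   = a , b , c , c∈T ,
    trans (*2≡⇒≡*½ (trans (halve γ₁) 2cγ₁≡2a+b)) (begin
      ℤ→ℚ (+ 2 ℤ.* a ℤ.+ b) * ½              ≡⟨ cong (_* ½) (trans (ℤ→ℚ-+ (+ 2 ℤ.* a) b) (cong (_+ ℤ→ℚ b) (ℤ→ℚ-* (+ 2) a))) ⟩
      (ℕ→ℚ 2 * ℤ→ℚ a + ℤ→ℚ b) * ½            ≡⟨ solve 4 (λ t a b h → (t :* a :+ b) :* h := a :* (t :* h) :+ b :* h)
                                                  refl (ℕ→ℚ 2) (ℤ→ℚ a) (ℤ→ℚ b) ½ ⟩
      ℤ→ℚ a * (ℕ→ℚ 2 * ½) + ℤ→ℚ b * ½        ≡⟨ cong (λ h → ℤ→ℚ a * h + ℤ→ℚ b * ½) 2*½≡1 ⟩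
      ℤ→ℚ a * 1ℚ + ℤ→ℚ b * ½                 ≡⟨ cong (_+ ℤ→ℚ b * ½) (ℚ.*-identityʳ (ℤ→ℚ a)) ⟩
      ℤ→ℚ a + ℤ→ℚ b * ½                      ∎) ,
    *2≡⇒≡*½ (trans (halve γ₂) 2cγ₂≡b)
    where
    open ≡-Reasoning
    halve : ∀ γ → ℕ→ℚ c * γ * ℕ→ℚ 2 ≡ ℕ→ℚ (2 ℕ.* c) * γ
    halve γ = trans (solve 3 (λ c γ t → c :* γ :* t := (t :* c) :* γ) refl (ℕ→ℚ c) γ (ℕ→ℚ 2))
                    (cong (_* γ) (sym (ℕ→ℚ-* 2 c)))

  euclidean-witness-≢3 : ∀ {S} → PrimeSet S → ∀ d → ¬ d % 4 ≡ 3 →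
    ∀ x y A B {L m k} b a .{{_ : NonZero L}} → SFree S L → InT S m → InT S k →
    x * ℕ→ℚ (L ℕ.* m) ≡ ℤ→ℚ A → y * ℕ→ℚ (L ℕ.* m) ≡ ℤ→ℚ B →
    (let T = + k ℤ.* B ℤ.- b ℤ.* + L in + (4 ℕ.* d) ℤ.* (T ℤ.* T) ℤ.< + 3 ℤ.* (+ L ℤ.* + L)) →
    ℤ.∣ + 2 ℤ.* + k ℤ.* A ℤ.- a ℤ.* (+ 2 ℤ.* + L) ∣ ℕ.≤ L →
    ∃[ γ ] (InOS d S γ × NS S (normK d ((x , y) -K γ)) < 1ℚ)
  euclidean-witness-≢3 S-primes d d≢3 x y A B {L} {m} {k} b a L-free m∈T k∈T xP≡A yP≡B 4dT²<3L² ∣u∣≤L =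
    (a ℚ./ c , b ℚ./ c) , InOS-≢3 d (a ℚ./ c) (b ℚ./ c) a b d≢3 c∈T (c*/≡ a) (c*/≡ b) ,
    NS-normK<1 S-primes d (x - a ℚ./ c) (y - b ℚ./ c) 1 c s T N c∈T L-free (sym (ℕ.*-identityˡ c))
      (clear-denominator x (a ℚ./ c) A a (L ℕ.* m) c k L xP≡A (z/n*n≡z a c) kP≡cL)
      (clear-denominator y (b ℚ./ c) B b (L ℕ.* m) c k L yP≡B (z/n*n≡z b c) kP≡cL)
      (sym (ℤ.*-identityˡ N)) (norm-bound (4 ℕ.* d) N u T 4N≡ ∣u∣≤L 4dT²<3L²)
    where
    c = k ℕ.* m
    c∈T = InT-* k∈T m∈T
    instance
      c-nonZero : NonZero c
      c-nonZero = ℕ.>-nonZero (proj₁ c∈T)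
    c*/≡ : ∀ z → ℕ→ℚ c * (z ℚ./ c) ≡ ℤ→ℚ z
    c*/≡ z = trans (ℚ.*-comm (ℕ→ℚ c) (z ℚ./ c)) (z/n*n≡z z c)
    kP≡cL : k ℕ.* (L ℕ.* m) ≡ c ℕ.* L
    kP≡cL = x∙yz≈xz∙y k L m
    s = + k ℤ.* A ℤ.- a ℤ.* + L
    T = + k ℤ.* B ℤ.- b ℤ.* + L
    N = s ℤ.* s ℤ.+ + d ℤ.* (T ℤ.* T)
    u = + 2 ℤ.* + k ℤ.* A ℤ.- a ℤ.* (+ 2 ℤ.* + L)
    4N≡ : + 4 ℤ.* N ≡ u ℤ.* u ℤ.+ + (4 ℕ.* d) ℤ.* (T ℤ.* T)
    4N≡ = trans (expand (+ k) A a (+ L) (+ d) T) (cong (λ D → u ℤ.* u ℤ.+ D ℤ.* (T ℤ.* T)) (sym (ℤ.pos-* 4 d)))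
      where
      expand : ∀ k A a L d T → + 4 ℤ.* ((k ℤ.* A ℤ.- a ℤ.* L) ℤ.* (k ℤ.* A ℤ.- a ℤ.* L) ℤ.+ d ℤ.* (T ℤ.* T))
        ≡ (+ 2 ℤ.* k ℤ.* A ℤ.- a ℤ.* (+ 2 ℤ.* L)) ℤ.* (+ 2 ℤ.* k ℤ.* A ℤ.- a ℤ.* (+ 2 ℤ.* L)) ℤ.+ + 4 ℤ.* d ℤ.* (T ℤ.* T)
      expand = solve-∀

  euclidean-step-≢3 : ∀ {S} → PrimeSet S → ∀ d → ¬ d % 4 ≡ 3 → Covered (discD d) S →
    ∀ x y A B {L m} .{{_ : NonZero L}} → SFree S L → InT S m →
    x * ℕ→ℚ (L ℕ.* m) ≡ ℤ→ℚ A → y * ℕ→ℚ (L ℕ.* m) ≡ ℤ→ℚ B →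
    ∃[ γ ] (InOS d S γ × NS S (normK d ((x , y) -K γ)) < 1ℚ)
  euclidean-step-≢3 {S} S-primes d d≢3 cov x y A B {L} {m} L-free m∈T xP≡A yP≡B =
    case covered⇒approximation {4 ℕ.* d} {S} (subst (λ D → Covered D S) (discD-≢3 d d≢3) cov) B L of λ where
      (k , k∈T , b , 4dT²<3L²) → case round-to-multiple (+ 2 ℤ.* + k ℤ.* A) L of λ where
        (a , ∣u∣≤L) → euclidean-witness-≢3 S-primes d d≢3 x y A B {L} {m} {k} b a L-free m∈T k∈T xP≡A yP≡B 4dT²<3L² ∣u∣≤L

  -- With w = (1 + √-d)/2 and d = 4q + 3, the norm of s + T w is s² + s T + (q + 1) T².
  norm-form-≡3 : ∀ d → d % 4 ≡ 3 → ∀ s T →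
    (+ 2 ℤ.* s ℤ.+ T) ℤ.* (+ 2 ℤ.* s ℤ.+ T) ℤ.+ + d ℤ.* (T ℤ.* T)
    ≡ + 4 ℤ.* (s ℤ.* s ℤ.+ s ℤ.* T ℤ.+ (+ (d / 4) ℤ.+ + 1) ℤ.* (T ℤ.* T))
  norm-form-≡3 d d≡3 s T = trans (cong (λ D → (+ 2 ℤ.* s ℤ.+ T) ℤ.* (+ 2 ℤ.* s ℤ.+ T) ℤ.+ D ℤ.* (T ℤ.* T)) d≡3+4q)
                                 (expand s T (+ (d / 4)))
    where
    d≡3+4q : + d ≡ + 3 ℤ.+ + (d / 4) ℤ.* + 4
    d≡3+4q = trans (cong +_ (trans (m≡m%n+[m/n]*n d 4) (cong (ℕ._+ d / 4 ℕ.* 4) d≡3)))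
                   (trans (ℤ.pos-+ 3 (d / 4 ℕ.* 4)) (cong (λ z → + 3 ℤ.+ z) (ℤ.pos-* (d / 4) 4)))
    expand : ∀ s T q → (+ 2 ℤ.* s ℤ.+ T) ℤ.* (+ 2 ℤ.* s ℤ.+ T) ℤ.+ (+ 3 ℤ.+ q ℤ.* + 4) ℤ.* (T ℤ.* T)
                       ≡ + 4 ℤ.* (s ℤ.* s ℤ.+ s ℤ.* T ℤ.+ (q ℤ.+ + 1) ℤ.* (T ℤ.* T))
    expand = solve-∀

  euclidean-witness-≡3 : ∀ {S} → PrimeSet S → ∀ d → d % 4 ≡ 3 →
    ∀ x y A B {L m k} b a .{{_ : NonZero L}} → SFree S L → InT S m → InT S k →
    x * ℕ→ℚ (L ℕ.* m) ≡ ℤ→ℚ A → y * ℕ→ℚ (L ℕ.* m) ≡ ℤ→ℚ B →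
    (let T = + k ℤ.* (+ 2 ℤ.* B) ℤ.- b ℤ.* + L in + d ℤ.* (T ℤ.* T) ℤ.< + 3 ℤ.* (+ L ℤ.* + L)) →
    ℤ.∣ + 2 ℤ.* + k ℤ.* (A ℤ.- B) ℤ.+ (+ k ℤ.* (+ 2 ℤ.* B) ℤ.- b ℤ.* + L) ℤ.- a ℤ.* (+ 2 ℤ.* + L) ∣ ℕ.≤ L →
    ∃[ γ ] (InOS d S γ × NS S (normK d ((x , y) -K γ)) < 1ℚ)
  euclidean-witness-≡3 S-primes d d≡3 x y A B {L} {m} {k} b a L-free m∈T k∈T xP≡A yP≡B dT²<3L² ∣u∣≤L =
    (γ₁ , γ₂) , InOS-≡3 d γ₁ γ₂ a b d≡3 c∈T (2c*/≡ α) (2c*/≡ b) ,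
    NS-normK<1 S-primes d (x - γ₁) (y - γ₂) 2 2c u T N c∈T L-free refl
      (trans (clear-denominator x γ₁ A α (L ℕ.* m) 2c (2 ℕ.* k) L xP≡A (z/n*n≡z α 2c) 2kP≡2cL) (cong ℤ→ℚ u-cleared))
      (trans (clear-denominator y γ₂ B b (L ℕ.* m) 2c (2 ℕ.* k) L yP≡B (z/n*n≡z b 2c) 2kP≡2cL) (cong ℤ→ℚ T-cleared))
      norm≡4N (norm-bound d N u T (sym norm≡4N) ∣u∣≤L dT²<3L²)
    where
    c = k ℕ.* m
    2c = 2 ℕ.* c
    c∈T = InT-* k∈T m∈T
    instance
      2c-nonZero : NonZero 2c
      2c-nonZero = ℕ.>-nonZero (ℕ.*-monoʳ-< 2 (proj₁ c∈T))
    α = + 2 ℤ.* a ℤ.+ b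
    γ₁ = α ℚ./ 2c
    γ₂ = b ℚ./ 2c
    2c*/≡ : ∀ z → ℕ→ℚ 2c * (z ℚ./ 2c) ≡ ℤ→ℚ z
    2c*/≡ z = trans (ℚ.*-comm (ℕ→ℚ 2c) (z ℚ./ 2c)) (z/n*n≡z z 2c)
    2kP≡2cL : 2 ℕ.* k ℕ.* (L ℕ.* m) ≡ 2c ℕ.* L
    2kP≡2cL = rearrange k L m
      where
      rearrange : ∀ k L m → 2 ℕ.* k ℕ.* (L ℕ.* m) ≡ 2 ℕ.* (k ℕ.* m) ℕ.* L
      rearrange = ℕ-Ring.solve-∀
    s = + k ℤ.* (A ℤ.- B) ℤ.- a ℤ.* + L
    T = + k ℤ.* (+ 2 ℤ.* B) ℤ.- b ℤ.* + L
    u = + 2 ℤ.* + k ℤ.* (A ℤ.- B) ℤ.+ T ℤ.- a ℤ.* (+ 2 ℤ.* + L)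
    N = s ℤ.* s ℤ.+ s ℤ.* T ℤ.+ (+ (d / 4) ℤ.+ + 1) ℤ.* (T ℤ.* T)
    u-cleared : + (2 ℕ.* k) ℤ.* A ℤ.- α ℤ.* + L ≡ u
    u-cleared = trans (cong (λ K → K ℤ.* A ℤ.- α ℤ.* + L) (ℤ.pos-* 2 k)) (expand (+ k) A B a b (+ L))
      where
      expand : ∀ k A B a b L → + 2 ℤ.* k ℤ.* A ℤ.- (+ 2 ℤ.* a ℤ.+ b) ℤ.* L
        ≡ + 2 ℤ.* k ℤ.* (A ℤ.- B) ℤ.+ (k ℤ.* (+ 2 ℤ.* B) ℤ.- b ℤ.* L) ℤ.- a ℤ.* (+ 2 ℤ.* L)
      expand = solve-∀
    T-cleared : + (2 ℕ.* k) ℤ.* B ℤ.- b ℤ.* + L ≡ T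
    T-cleared = trans (cong (λ K → K ℤ.* B ℤ.- b ℤ.* + L) (ℤ.pos-* 2 k)) (expand (+ k) B b (+ L))
      where
      expand : ∀ k B b L → + 2 ℤ.* k ℤ.* B ℤ.- b ℤ.* L ≡ k ℤ.* (+ 2 ℤ.* B) ℤ.- b ℤ.* L
      expand = solve-∀
    norm≡4N : u ℤ.* u ℤ.+ + d ℤ.* (T ℤ.* T) ≡ + 4 ℤ.* N
    norm≡4N = trans (cong (λ v → v ℤ.* v ℤ.+ + d ℤ.* (T ℤ.* T)) (u≡2s+T (+ k) A B a (+ L) T)) (norm-form-≡3 d d≡3 s T)
      where
      u≡2s+T : ∀ k A B a L T → + 2 ℤ.* k ℤ.* (A ℤ.- B) ℤ.+ T ℤ.- a ℤ.* (+ 2 ℤ.* L) ≡ + 2 ℤ.* (k ℤ.* (A ℤ.- B) ℤ.- a ℤ.* L) ℤ.+ T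
      u≡2s+T = solve-∀

  euclidean-step-≡3 : ∀ {S} → PrimeSet S → ∀ d → d % 4 ≡ 3 → Covered (discD d) S →
    ∀ x y A B {L m} .{{_ : NonZero L}} → SFree S L → InT S m →
    x * ℕ→ℚ (L ℕ.* m) ≡ ℤ→ℚ A → y * ℕ→ℚ (L ℕ.* m) ≡ ℤ→ℚ B →
    ∃[ γ ] (InOS d S γ × NS S (normK d ((x , y) -K γ)) < 1ℚ)
  euclidean-step-≡3 {S} S-primes d d≡3 cov x y A B {L} {m} L-free m∈T xP≡A yP≡B =
    case covered⇒approximation {d} {S} (subst (λ D → Covered D S) (discD-≡3 d d≡3) cov) (+ 2 ℤ.* B) L of λ where
      (k , k∈T , b , dT²<3L²) →
        case round-to-multiple (+ 2 ℤ.* + k ℤ.* (A ℤ.- B) ℤ.+ (+ k ℤ.* (+ 2 ℤ.* B) ℤ.- b ℤ.* + L)) L of λ where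
          (a , ∣u∣≤L) → euclidean-witness-≡3 S-primes d d≡3 x y A B {L} {m} {k} b a
                          L-free m∈T k∈T xP≡A yP≡B dT²<3L² ∣u∣≤L

open S-Parts
open Rationals
open EuclideanWitnesses
open import Data.Nat as ℕ using (ℕ; NonZero; _<_)
import Data.Nat.Properties as ℕ
open import Data.Nat.DivMod using (_%_)
open import Data.Integer as ℤ using (ℤ)
open import Data.Rational as ℚ using (↥_; ↧_; ↧ₙ_; 1ℚ; _*_)
open import Data.List using (List)
open import Data.Product using (∃-syntax; _×_; _,_)
open import Function using (case_of_)
open import Relation.Binary.PropositionalEquality
open import Relation.Nullary using (yes; no)

euclidean-step : ∀ {S} → PrimeSet S → ∀ d → Covered (discD d) S →
  ∀ x y A B {L m} .{{_ : NonZero L}} → SFree S L → InT S m →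
  x * ℕ→ℚ (L ℕ.* m) ≡ ℤ→ℚ A → y * ℕ→ℚ (L ℕ.* m) ≡ ℤ→ℚ B →
  ∃[ γ ] (InOS d S γ × NS S (normK d ((x , y) -K γ)) ℚ.< 1ℚ)
euclidean-step S-primes d cov x y A B L-free m∈T xP≡A yP≡B = case d % 4 ℕ.≟ 3 of λ where
  (yes d≡3) → euclidean-step-≡3 S-primes d d≡3 cov x y A B L-free m∈T xP≡A yP≡B
  (no  d≢3) → euclidean-step-≢3 S-primes d d≢3 cov x y A B L-free m∈T xP≡A yP≡B

-- The hypotheses 0 < d and d squarefree are unused: the construction of γ works for every d.
lemma3 : (d : ℕ) → 0 < d → Squarefree d → (S : List ℕ) → PrimeSet S →
    Covered (discD d) S → SNormEuclidean d S
lemma3 d _ _ S S-primes cov (x , y) = case stripS-decomposition S-primes 0<P of (λ where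
  (L-free , m , m∈T , P≡Lm) → euclidean-step S-primes d cov x y (↥ x ℤ.* ↧ y) (↥ y ℤ.* ↧ x) L-free m∈T
    (subst (λ n → x * ℕ→ℚ n ≡ ℤ→ℚ (↥ x ℤ.* ↧ y)) P≡Lm (*-common-denominator x y))
    (subst (λ n → y * ℕ→ℚ n ≡ ℤ→ℚ (↥ y ℤ.* ↧ x)) P≡Lm
      (subst (λ n → y * ℕ→ℚ n ≡ ℤ→ℚ (↥ y ℤ.* ↧ x)) (ℕ.*-comm (↧ₙ y) (↧ₙ x)) (*-common-denominator y x))))
  where
  P = ↧ₙ x ℕ.* ↧ₙ y
  0<P : 0 < P
  0<P = ℕ.>-nonZero⁻¹ P {{ℕ.m*n≢0 (↧ₙ x) (↧ₙ y)}}
  instance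
    L-nonZero : NonZero (stripS S P)
    L-nonZero = ℕ.>-nonZero (stripS-pos S-primes 0<P)
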